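{- Let $L$ be a Latin square of order $n \geq 1$ and let $a$ be an integer with $0\le 2a\le n$. Any $(n+a)$-cover of $L$ contains a partial transversal of deficit $2a$.
   Context: A Latin square of order $n$ is an $n\times n$ array on $n$ symbols in which each symbol occurs once in each row and each column; its set of entries is $E(L)=\{(i,j,L_{ij})\}$. A line is the set of all entries in a given row, in a given column, or with a given symbol. A cover is a subset of $E(L)$ meeting every line; an $(n+a)$-cover is a cover of size $n+a$. A partial transversal of deficit $d$ is an $(n-d)$-subset of $E(L)$ in which every line is represented at most once. -}

module Defs where

open import Data.Nat using (ℕ; _∸_)
open import Data.Fin using (Fin)
open import Data.Product using (Σ; ∃; _×_; _,_; proj₁; proj₂)
open import Data.List using (List; length)
open import Data.List.Membership.Propositional using (_∈_)
open import Data.List.Relation.Unary.Unique.Propositional using (Unique)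
open import Data.List.Relation.Binary.Subset.Propositional using (_⊆_)
open import Relation.Binary.PropositionalEquality using (_≡_; _≢_)

Array : ℕ → Set
Array n = Fin n → Fin n → Fin n

record IsLatinSquare {n : ℕ} (L : Array n) : Set where
  field
    rowOnce : ∀ (i s : Fin n) → Σ (Fin n) λ j → (L i j ≡ s) × (∀ j′ → L i j′ ≡ s → j′ ≡ j)
    colOnce : ∀ (j s : Fin n) → Σ (Fin n) λ i → (L i j ≡ s) × (∀ i′ → L i′ j ≡ s → i′ ≡ i)

Entry : ℕ → Set
Entry n = Fin n × Fin n × Fin n

row col sym : ∀ {n} → Entry n → Fin n
row (i , _ , _) = i
col (_ , j , _) = j
sym (_ , _ , s) = s

IsEntry : ∀ {n} → Array n → Entry n → Set
IsEntry L (i , j , s) = L i j ≡ s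

-- A finite subset of E(L), represented as a duplicate-free list of entries of L.
record SubsetOfE {n : ℕ} (L : Array n) (S : List (Entry n)) : Set where
  field
    entries : ∀ {e} → e ∈ S → IsEntry L e
    noDup   : Unique S

IsCover : ∀ {n} → Array n → List (Entry n) → Set
IsCover {n} L S =
  SubsetOfE L S ×
  (∀ (i : Fin n) → ∃ λ e → e ∈ S × row e ≡ i) ×
  (∀ (j : Fin n) → ∃ λ e → e ∈ S × col e ≡ j) ×
  (∀ (s : Fin n) → ∃ λ e → e ∈ S × sym e ≡ s)

IsSizedCover : ∀ {n} → Array n → ℕ → List (Entry n) → Set
IsSizedCover {n} L m S = IsCover L S × length S ≡ m

IsPartialTransversal : ∀ {n} → Array n → ℕ → List (Entry n) → Set
IsPartialTransversal {n} L d T =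
  SubsetOfE L T ×
  length T ≡ n ∸ d ×
  (∀ {e f} → e ∈ T → f ∈ T → row e ≡ row f → e ≡ f) ×
  (∀ {e f} → e ∈ T → f ∈ T → col e ≡ col f → e ≡ f) ×
  (∀ {e f} → e ∈ T → f ∈ T → sym e ≡ sym f → e ≡ f)

module Submission where

-- A greedy argument.  Scan the cover C entry by entry, keeping a list T ⊆ C of
-- entries that pairwise share no line: an entry is appended to T exactly when
-- its row, column and symbol are all fresh for T.  Let lines(S) be the number
-- of distinct rows, plus distinct columns, plus distinct symbols met by S.
-- An appended entry raises lines by at most 3 and |T| by one; a rejected
-- entry meets a line already met by T ⊆ S, so it raises lines by at most 2.
-- Hence the invariant  lines(S) ≤ |T| + 2|S|  survives every step.
-- For an (n+a)-cover, lines(C) = 3n, so 3n ≤ |T| + 2(n + a), i.e.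
-- |T| ≥ n − 2a, and the first n − 2a entries of T form the required partial
-- transversal.

open import Defs
open import Data.Nat using (ℕ; suc; _+_; _*_; _∸_; _≤_; z≤n)
open import Data.Nat.Properties
open import Data.Nat.Tactic.RingSolver using (solve-∀)
open import Data.Fin using (Fin; toℕ)
import Data.Fin.Properties as Fin
open import Data.Product using (Σ; ∃; _×_; _,_)
open import Data.Sum using (_⊎_; inj₁; inj₂)
import Data.Sum
open import Data.Empty using (⊥-elim)
open import Data.List using (List; []; _∷_; length; map; take; lookup)
open import Data.List.Properties using (length-take)
open import Data.List.Membership.Propositional using (_∈_; _∉_)
open import Data.List.Membership.Propositional.Properties using (∈-map⁺)
import Data.List.Membership.DecPropositional as DecMembership
open import Data.List.Relation.Unary.Any using (here; there; index)
open import Data.List.Relation.Unary.Any.Properties using (lookup-index)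
open import Data.List.Relation.Unary.All.Properties using (¬Any⇒All¬)
open import Data.List.Relation.Unary.AllPairs using (_∷_)
open import Data.List.Relation.Unary.Unique.Propositional using (Unique; [])
import Data.List.Relation.Unary.Unique.Propositional.Properties as Unique
open import Data.List.Relation.Binary.Subset.Propositional using (_⊆_)
import Data.List.Relation.Binary.Subset.Propositional.Properties as Subset
import Data.List.Relation.Binary.Sublist.Propositional as Sublist
import Data.List.Relation.Binary.Sublist.Propositional.Properties as Sublist
open import Relation.Nullary using (¬_; Dec; yes; no)
open import Relation.Binary.Definitions using (DecidableEquality)
open import Relation.Binary.PropositionalEquality
  using (_≡_; refl; trans; cong; subst; module ≡-Reasoning)
  renaming (sym to ≡-sym)

none-or-some : ∀ {A B C : Set} → Dec A → Dec B → Dec C →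
               (¬ A × ¬ B × ¬ C) ⊎ (A ⊎ B ⊎ C)
none-or-some (yes a) _       _       = inj₂ (inj₁ a)
none-or-some (no _)  (yes b) _       = inj₂ (inj₂ (inj₁ b))
none-or-some (no _)  (no _)  (yes c) = inj₂ (inj₂ (inj₂ c))
none-or-some (no ¬a) (no ¬b) (no ¬c) = inj₁ (¬a , ¬b , ¬c)

module Dedup {A : Set} (_≟_ : DecidableEquality A) where
  open DecMembership _≟_ using (_∈?_)

  dedup : List A → List A
  dedup []       = []
  dedup (x ∷ xs) with x ∈? xs
  ... | yes _ = dedup xs
  ... | no  _ = x ∷ dedup xs

  dedup-cons-≤ : ∀ x xs → length (dedup (x ∷ xs)) ≤ length (dedup xs) + 1
  dedup-cons-≤ x xs with x ∈? xs
  ... | yes _ = m≤m+n _ 1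
  ... | no  _ = ≤-reflexive (+-comm 1 _)

  dedup-cons-∈ : ∀ x xs → x ∈ xs → length (dedup (x ∷ xs)) ≤ length (dedup xs)
  dedup-cons-∈ x xs x∈xs with x ∈? xs
  ... | yes _   = ≤-refl
  ... | no  x∉xs = ⊥-elim (x∉xs x∈xs)

  ∈-dedup : ∀ {y} xs → y ∈ xs → y ∈ dedup xs
  ∈-dedup (x ∷ xs) y∈ with x ∈? xs | y∈
  ... | yes x∈xs | here refl = ∈-dedup xs x∈xs
  ... | yes _    | there y∈xs = ∈-dedup xs y∈xs
  ... | no  _    | here refl = here refl
  ... | no  _    | there y∈xs = there (∈-dedup xs y∈xs)

-- Pigeonhole: a list containing every element of Fin n has length ≥ n,
-- since otherwise two elements of Fin n would share a position in it.
exhaustive⇒≥ : ∀ {n} (xs : List (Fin n)) → (∀ i → i ∈ xs) → n ≤ length xs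
exhaustive⇒≥ {n} xs has with n ≤? length xs
... | yes n≤ = n≤
... | no  n≰ with Fin.pigeonhole (≰⇒> n≰) (λ i → index (has i))
... | i , j , i<j , same = ⊥-elim (<⇒≢ i<j (cong toℕ i≡j))
  where
  open ≡-Reasoning
  i≡j : i ≡ j
  i≡j = begin
    i                         ≡⟨ lookup-index (has i) ⟩
    lookup xs (index (has i)) ≡⟨ cong (lookup xs) same ⟩
    lookup xs (index (has j)) ≡⟨ ≡-sym (lookup-index (has j)) ⟩
    j                         ∎

sum3-≤ : ∀ {a a′ b b′ c c′} x y z → a′ ≤ a + x → b′ ≤ b + y → c′ ≤ c + z →
         a′ + b′ + c′ ≤ (a + b + c) + (x + y + z)
sum3-≤ {a} {_} {b} {_} {c} x y z p q r =
  ≤-trans (+-mono-≤ (+-mono-≤ p q) r) (≤-reflexive (regroup a b c x y z))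
  where
  regroup : ∀ a b c x y z → a + x + (b + y) + (c + z) ≡ a + b + c + (x + y + z)
  regroup = solve-∀

take-⊆ : ∀ {A : Set} k (xs : List A) → take k xs ⊆ xs
take-⊆ k xs = Sublist.lookup (Sublist.take-⊆ k xs)

module _ {n : ℕ} where
  open Dedup (Fin._≟_ {n})
  open DecMembership (Fin._≟_ {n}) using (_∈?_)

  lineCount : (Entry n → Fin n) → List (Entry n) → ℕ
  lineCount f S = length (dedup (map f S))

  linesMet : List (Entry n) → ℕ
  linesMet S = lineCount row S + lineCount col S + lineCount sym S

  meets-all⇒n≤lineCount : ∀ f S → (∀ i → ∃ λ e → e ∈ S × f e ≡ i) →
                          n ≤ lineCount f S
  meets-all⇒n≤lineCount f S meets =
    exhaustive⇒≥ (dedup (map f S)) (λ i → ∈-dedup (map f S) (f-values i))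
    where
    f-values : ∀ i → i ∈ map f S
    f-values i with meets i
    ... | e , e∈S , refl = ∈-map⁺ f e∈S

  lineCount-cons : ∀ f e S → lineCount f (e ∷ S) ≤ lineCount f S + 1
  lineCount-cons f e S = dedup-cons-≤ (f e) (map f S)

  lineCount-cons-met : ∀ f e S → f e ∈ map f S → lineCount f (e ∷ S) ≤ lineCount f S + 0
  lineCount-cons-met f e S met = m≤n⇒m≤n+o 0 (dedup-cons-∈ (f e) (map f S) met)

  linesMet-cons : ∀ e S → linesMet (e ∷ S) ≤ linesMet S + 3
  linesMet-cons e S =
    sum3-≤ 1 1 1 (lineCount-cons row e S) (lineCount-cons col e S) (lineCount-cons sym e S)

  linesMet-cons-met : ∀ e S →
    row e ∈ map row S ⊎ col e ∈ map col S ⊎ sym e ∈ map sym S →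
    linesMet (e ∷ S) ≤ linesMet S + 2
  linesMet-cons-met e S (inj₁ r) =
    sum3-≤ 0 1 1 (lineCount-cons-met row e S r) (lineCount-cons col e S) (lineCount-cons sym e S)
  linesMet-cons-met e S (inj₂ (inj₁ c)) =
    sum3-≤ 1 0 1 (lineCount-cons row e S) (lineCount-cons-met col e S c) (lineCount-cons sym e S)
  linesMet-cons-met e S (inj₂ (inj₂ s)) =
    sum3-≤ 1 1 0 (lineCount-cons row e S) (lineCount-cons col e S) (lineCount-cons-met sym e S s)

  LineInjective : (Entry n → Fin n) → List (Entry n) → Set
  LineInjective f T = ∀ {e g} → e ∈ T → g ∈ T → f e ≡ f g → e ≡ g

  record Independent (T : List (Entry n)) : Set where
    field
      unique : Unique T
      rowInj : LineInjective row T
      colInj : LineInjective col T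
      symInj : LineInjective sym T

  LineInjective-⊆ : ∀ f {T U} → U ⊆ T → LineInjective f T → LineInjective f U
  LineInjective-⊆ f U⊆T inj e∈U g∈U = inj (U⊆T e∈U) (U⊆T g∈U)

  LineInjective-cons : ∀ f e T → f e ∉ map f T → LineInjective f T →
                       LineInjective f (e ∷ T)
  LineInjective-cons f e T fresh inj (here refl) (here refl) _  = refl
  LineInjective-cons f e T fresh inj (here refl) (there g∈T) eq =
    ⊥-elim (fresh (subst (_∈ map f T) (≡-sym eq) (∈-map⁺ f g∈T)))
  LineInjective-cons f e T fresh inj (there e∈T) (here refl) eq =
    ⊥-elim (fresh (subst (_∈ map f T) eq (∈-map⁺ f e∈T)))
  LineInjective-cons f e T fresh inj (there e∈T) (there g∈T) eq = inj e∈T g∈T eq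

  Independent-[] : Independent []
  Independent-[] = record
    { unique = [] ; rowInj = λ () ; colInj = λ () ; symInj = λ () }

  Independent-cons : ∀ e T → row e ∉ map row T → col e ∉ map col T →
                     sym e ∉ map sym T → Independent T → Independent (e ∷ T)
  Independent-cons e T fr fc fs ind = record
    { unique = ¬Any⇒All¬ T (λ e∈T → fr (∈-map⁺ row e∈T)) ∷ unique
    ; rowInj = LineInjective-cons row e T fr rowInj
    ; colInj = LineInjective-cons col e T fc colInj
    ; symInj = LineInjective-cons sym e T fs symInj
    }
    where open Independent ind

  Independent-take : ∀ k {T} → Independent T → Independent (take k T)
  Independent-take k {T} ind = record
    { unique = Unique.take⁺ k unique
    ; rowInj = LineInjective-⊆ row (take-⊆ k T) rowInj
    ; colInj = LineInjective-⊆ col (take-⊆ k T) colInj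
    ; symInj = LineInjective-⊆ sym (take-⊆ k T) symInj
    }
    where open Independent ind

  greedy : ∀ S → Σ (List (Entry n)) λ T →
           T ⊆ S × Independent T × linesMet S ≤ length T + 2 * length S
  greedy [] = [] , (λ ()) , Independent-[] , z≤n
  greedy (e ∷ S) with greedy S
  ... | T , T⊆S , indT , bound
      with none-or-some (row e ∈? map row T) (col e ∈? map col T) (sym e ∈? map sym T)
  ... | inj₁ (fr , fc , fs) =
    e ∷ T , Subset.∷⁺ʳ e T⊆S , Independent-cons e T fr fc fs indT ,
    ≤-trans (linesMet-cons e S)
      (≤-trans (+-monoˡ-≤ 3 bound) (≤-reflexive (accepted (length T) (length S))))
    where
    accepted : ∀ t s → t + 2 * s + 3 ≡ suc t + 2 * suc s
    accepted = solve-∀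
  ... | inj₂ met =
    T , Subset.⊆-trans T⊆S (Subset.xs⊆x∷xs S e) , indT ,
    ≤-trans (linesMet-cons-met e S (Data.Sum.map (lift row) (Data.Sum.map (lift col) (lift sym)) met))
      (≤-trans (+-monoˡ-≤ 2 bound) (≤-reflexive (rejected (length T) (length S))))
    where
    lift : ∀ f → f e ∈ map f T → f e ∈ map f S
    lift f = Subset.map⁺ f T⊆S
    rejected : ∀ t s → t + 2 * s + 2 ≡ t + 2 * suc s
    rejected = solve-∀

  independent⇒partialTransversal : ∀ {L : Array n} {C T} d →
    SubsetOfE L C → T ⊆ C → Independent T → length T ≡ n ∸ d →
    IsPartialTransversal L d T
  independent⇒partialTransversal d C⊆E T⊆C ind |T| =
    record { entries = λ e∈T → SubsetOfE.entries C⊆E (T⊆C e∈T)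
           ; noDup   = unique } ,
    |T| , rowInj , colInj , symInj
    where open Independent ind

deficit-bound : ∀ n a t → n + n + n ≤ t + 2 * (n + a) → n ∸ 2 * a ≤ t
deficit-bound n a t le =
  m≤n+o⇒m∸n≤o n (2 * a) (+-cancelˡ-≤ (n + n) n (2 * a + t)
    (≤-trans le (≤-reflexive (regroup n a t))))
  where
  regroup : ∀ n a t → t + 2 * (n + a) ≡ n + n + (2 * a + t)
  regroup = solve-∀

theorem2p3 : ∀ (n : ℕ) → 1 ≤ n → (L : Array n) → IsLatinSquare L →
    (a : ℕ) → 2 * a ≤ n →
    (C : List (Entry n)) → IsSizedCover L (n + a) C →
    Σ (List (Entry n)) λ T → T ⊆ C × IsPartialTransversal L (2 * a) T
theorem2p3 n _ L _ a _ C ((C⊆E , rows , cols , syms) , |C|) with greedy C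
... | T , T⊆C , indT , bound =
  take k T , prefix⊆C ,
  independent⇒partialTransversal (2 * a) C⊆E prefix⊆C (Independent-take k indT)
    (trans (length-take k T) (m≤n⇒m⊓n≡m enough))
  where
  k : ℕ
  k = n ∸ 2 * a
  prefix⊆C : take k T ⊆ C
  prefix⊆C = Subset.⊆-trans (take-⊆ k T) T⊆C
  allLines : n + n + n ≤ linesMet C
  allLines = +-mono-≤ (+-mono-≤ (meets-all⇒n≤lineCount row C rows)
                                (meets-all⇒n≤lineCount col C cols))
                      (meets-all⇒n≤lineCount sym C syms)
  enough : k ≤ length T
  enough = deficit-bound n a (length T)
             (≤-trans allLines (subst (λ m → linesMet C ≤ length T + 2 * m) |C| bound))
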